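{- For any $QLP(\mathcal{D})$ program $\mathcal{P}$ the following hold: (1) for every Herbrand interpretation $\mathcal{I}$: $\mathcal{I} \models \mathcal{P} \iff T_{\mathcal{P}}(\mathcal{I}) \subseteq \mathcal{I}$; (2) $T_{\mathcal{P}}$ is monotonic and continuous; (3) the least fixpoint $\mu(T_{\mathcal{P}})$ is the least Herbrand model of $\mathcal{P}$, denoted $\mathcal{M}_{\mathcal{P}}$; (4) $\mathcal{M}_{\mathcal{P}} = \bigcup_{n\in\mathbb{N}} T_{\mathcal{P}}\uparrow^{n}(\emptyset) = \{A\sharp d \mid \mathcal{P} \vdash_{QHL(\mathcal{D})} A\sharp d\}$.
   Context: A qualification domain $\mathcal{D} = \langle D, \sqsubseteq, \bot, \top, \circ\rangle$ is a lattice with extreme points $\bot,\top$ (with $\sqcap$ the binary greatest lower bound) together with an attenuation operation $\circ : D\times D\to D$ that is associative, commutative, monotonic, satisfies $d\circ\top = d$, $d\circ\bot=\bot$, $d\circ e \sqsubset e$ for $d,e\in D\setminus\{\bot,\top\}$, and $d\circ(e_1\sqcap e_2) = d\circ e_1 \sqcap d\circ e_2$. For a finite set $S=\{e_1,\dots,e_n\}\subseteq D$, $\mathrm{glb}\,S = e_1\sqcap\cdots\sqcap e_n$ (which is $\top$ when $n=0$). Terms are built from constructors of a signature $\Sigma$ and variables; atoms are $p(t_1,\dots,t_n)$ with $p$ a predicate symbol. A $QLP(\mathcal{D})$ program $\mathcal{P}$ is a set of clauses $A \xleftarrow{d} B_1,\dots,B_k$ with $A,B_i$ atoms and $d\in D\setminus\{\bot\}$.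 A $\mathcal{D}$-annotated atom is $A\sharp d$ with $d\in D\setminus\{\bot\}$; $A\sharp d$ entails $A'\sharp d'$ iff $A'=A\theta$ for some substitution $\theta$ and $d'\sqsubseteq d$. A (open) Herbrand interpretation is a set of $\mathcal{D}$-annotated atoms closed under this entailment; interpretations form a complete lattice under $\subseteq$ with union as lub and intersection as glb. $\mathcal{I}$ is a model of clause $A \xleftarrow{d} B_1,\dots,B_k$ iff for every substitution $\theta$ and $d_1,\dots,d_k\in D\setminus\{\bot\}$ with $B_i\theta\sharp d_i\in\mathcal{I}$ for all $i$, one has $A\theta\sharp(d\circ \mathrm{glb}\{d_1,\dots,d_k\})\in\mathcal{I}$; $\mathcal{I}\models\mathcal{P}$ iff $\mathcal{I}$ is a model of every clause of $\mathcal{P}$. The operator $T_{\mathcal{P}}$ on interpretations is $T_{\mathcal{P}}(\mathcal{I}) = \{A'\sharp d' \mid (A \xleftarrow{d} B_1,\dots,B_k)\in\mathcal{P},\ \theta \text{ substitution},\ B_i\theta\sharp d_i\in\mathcal{I}\ (1\le i\le k),\ A'=A\theta,\ d'\in D\setminus\{\bot\},\ d'\sqsubseteq d\circ\mathrm{glb}\{d_1,\dots,d_k\}\}$. The logic $QHL(\mathcal{D})$ has a single inference rule: from $B'_1\sharp d_1,\dots,B'_k\sharp d_k$ infer $A'\sharp d'$ whenever there is a clause $(A \xleftarrow{d} B_1,\dots,B_k)\in\mathcal{P}$ and a substitution $\theta$ with $A'=A\theta$, $B'_i=B_i\theta$ and $d'\sqsubseteq d\circ\mathrm{glb}\{d_1,\dots,d_k\}$;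 $\mathcal{P}\vdash_{QHL(\mathcal{D})} A\sharp d$ means derivable in finitely many steps. -}

module Defs where

open import Data.Nat using (ℕ; zero; suc)
open import Data.List using (List; foldr)
open import Data.List.Relation.Binary.Pointwise using (Pointwise)
open import Data.Vec using (Vec; []; _∷_)
open import Data.Product using (Σ; Σ-syntax; ∃; ∃-syntax; _×_; _,_)
open import Data.Empty using (⊥)
open import Relation.Binary.PropositionalEquality using (_≡_; _≢_)
open import Relation.Binary.Lattice.Structures using (IsBoundedLattice)

record QualificationDomain : Set₁ where
  infix  4 _⊑_ _⊏_
  infixr 7 _⊓_
  infixr 6 _⊔_
  infixr 8 _∘_
  field
    D     : Set
    _⊑_   : D → D → Set
    _⊔_   : D → D → D
    _⊓_   : D → D → D
    ⊤D    : D
    ⊥D    : D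
    isBoundedLattice : IsBoundedLattice _≡_ _⊑_ _⊔_ _⊓_ ⊤D ⊥D
    _∘_       : D → D → D
    ∘-assoc   : ∀ d e f → (d ∘ e) ∘ f ≡ d ∘ (e ∘ f)
    ∘-comm    : ∀ d e → d ∘ e ≡ e ∘ d
    ∘-mono    : ∀ {d d′ e e′} → d ⊑ d′ → e ⊑ e′ → d ∘ e ⊑ d′ ∘ e′
    ∘-identity : ∀ d → d ∘ ⊤D ≡ d
    ∘-zero    : ∀ d → d ∘ ⊥D ≡ ⊥D
    ∘-strict  : ∀ d e → d ≢ ⊥D → d ≢ ⊤D → e ≢ ⊥D → e ≢ ⊤D
              → (d ∘ e ⊑ e) × (d ∘ e ≢ e)
    ∘-distrib-⊓ : ∀ d e₁ e₂ → d ∘ (e₁ ⊓ e₂) ≡ (d ∘ e₁) ⊓ (d ∘ e₂)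

  _⊏_ : D → D → Set
  d ⊏ e = (d ⊑ e) × (d ≢ e)

  glb : List D → D
  glb = foldr _⊓_ ⊤D

record Signature : Set₁ where
  field
    Con       : Set
    conArity  : Con → ℕ
    PredSym   : Set
    predArity : PredSym → ℕ

module Syntax (Sg : Signature) where
  open Signature Sg

  data Term : Set where
    var : ℕ → Term
    con : (c : Con) → Vec Term (conArity c) → Term

  Subst : Set
  Subst = ℕ → Term

  mutual
    _⟪_⟫ : Term → Subst → Term
    var x    ⟪ θ ⟫ = θ x
    con c ts ⟪ θ ⟫ = con c (ts ⟪ θ ⟫*)

    _⟪_⟫* : ∀ {n} → Vec Term n → Subst → Vec Term n
    []       ⟪ θ ⟫* = []
    (t ∷ ts) ⟪ θ ⟫* = (t ⟪ θ ⟫) ∷ (ts ⟪ θ ⟫*)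

  record Atom : Set where
    constructor atom
    field
      pred : PredSym
      args : Vec Term (predArity pred)

  _·_ : Atom → Subst → Atom
  atom p ts · θ = atom p (ts ⟪ θ ⟫*)

module QLP (𝒟 : QualificationDomain) (Sg : Signature) where
  open QualificationDomain 𝒟
  open Syntax Sg public

  record Clause : Set where
    constructor _←[_,_]−_
    field
      head  : Atom
      qual  : D
      qual≢⊥ : qual ≢ ⊥D
      body  : List Atom

  Program : Set₁
  Program = Clause → Set

  -- A set of D-annotated atoms A ♯ d, given by its membership predicate
  -- (I A d  means  A ♯ d ∈ I).
  AtomSet : Set₁
  AtomSet = Atom → D → Set

  -- (open) Herbrand interpretations: sets of D-annotated atoms (d ≠ ⊥)
  -- closed under entailment.
  record IsInterpretation (I : AtomSet) : Set where
    field
      annotated : ∀ A d → I A d → d ≢ ⊥D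
      closed    : ∀ A d → I A d → ∀ (θ : Subst) d′ → d′ ≢ ⊥D → d′ ⊑ d → I (A · θ) d′

  infix 4 _⊆_ _≐_
  _⊆_ : AtomSet → AtomSet → Set
  I ⊆ J = ∀ A d → I A d → J A d

  _≐_ : AtomSet → AtomSet → Set
  I ≐ J = (I ⊆ J) × (J ⊆ I)

  ∅ : AtomSet
  ∅ _ _ = ⊥

  ⋃ : {X : Set} → (X → AtomSet) → AtomSet
  ⋃ {X} F A d = Σ[ x ∈ X ] F x A d

  BodyIn : AtomSet → Subst → List Atom → List D → Set
  BodyIn I θ Bs ds = Pointwise (λ B e → I (B · θ) e) Bs ds

  -- I ⊨ A ←d− B₁,…,Bₖ  (the condition  Aθ ♯ (d ∘ glb{dᵢ}) ∈ I  is only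
  -- imposed when  d ∘ glb{dᵢ} ≠ ⊥, since A ♯ ⊥ is not an annotated atom)
  _⊨C_ : AtomSet → Clause → Set
  I ⊨C (A ←[ d , _ ]− Bs) =
    ∀ (θ : Subst) (ds : List D) → BodyIn I θ Bs ds →
    d ∘ glb ds ≢ ⊥D → I (A · θ) (d ∘ glb ds)

  _⊨_ : AtomSet → Program → Set
  I ⊨ P = ∀ C → P C → I ⊨C C

  T : Program → AtomSet → AtomSet
  T P I A′ d′ =
    Σ[ C ∈ Clause ] P C ×
    Σ[ θ ∈ Subst ] Σ[ ds ∈ List D ]
      BodyIn I θ (Clause.body C) ds ×
      A′ ≡ Clause.head C · θ ×
      d′ ≢ ⊥D ×
      d′ ⊑ Clause.qual C ∘ glb ds

  T↑ : Program → ℕ → AtomSet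
  T↑ P zero    = ∅
  T↑ P (suc n) = T P (T↑ P n)

  data _⊢_♯_ (P : Program) : Atom → D → Set where
    rule : ∀ (C : Clause) → P C → (θ : Subst) (ds : List D) →
           Pointwise (λ B e → P ⊢ B · θ ♯ e) (Clause.body C) ds →
           ∀ d′ → d′ ≢ ⊥D → d′ ⊑ Clause.qual C ∘ glb ds →
           P ⊢ Clause.head C · θ ♯ d′

  Derivable : Program → AtomSet
  Derivable P A d = P ⊢ A ♯ d

  Monotonic : (AtomSet → AtomSet) → Set₁
  Monotonic F = ∀ I J → IsInterpretation I → IsInterpretation J →
                I ⊆ J → F I ⊆ F J

  record IsDirected {X : Set} (F : X → AtomSet) : Set where
    field
      interp   : ∀ x → IsInterpretation (F x)
      nonempty : X
      upper    : ∀ x y → Σ[ z ∈ X ] (F x ⊆ F z × F y ⊆ F z)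

  Continuous : (AtomSet → AtomSet) → Set₁
  Continuous F = ∀ (X : Set) (G : X → AtomSet) → IsDirected G →
                 F (⋃ G) ≐ ⋃ (λ x → F (G x))

  IsLeastFixpoint : (AtomSet → AtomSet) → AtomSet → Set₁
  IsLeastFixpoint F M =
    IsInterpretation M × F M ≐ M ×
    (∀ J → IsInterpretation J → F J ≐ J → M ⊆ J)

  IsLeastModel : Program → AtomSet → Set₁
  IsLeastModel P M =
    IsInterpretation M × M ⊨ P ×
    (∀ J → IsInterpretation J → J ⊨ P → M ⊆ J)

-- T_P is the operator whose prefixpoints are exactly the models of P. Since
-- clause bodies are finite, a body satisfied in a directed union is already
-- satisfied in one member, so T_P is continuous and Kleene's construction
-- ⋃ₙ T_P↑ⁿ(∅) is its least fixpoint, contained in every prefixpoint; hence it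
-- is also the least model. A QHL(D)-derivation is a finite tree of T_P-steps,
-- so the derivable annotated atoms lie in every prefixpoint too, and the
-- derivable set is itself a prefixpoint: the two sets coincide.
module Submission where

open import Defs
open import Data.Nat using (ℕ; zero; suc; _≤_; _⊔_; z≤n; s≤s)
open import Data.Nat.Properties using (m≤m⊔n; m≤n⊔m; n≤1+n)
open import Data.Product using (Σ-syntax; _×_; _,_; proj₁; proj₂)
open import Function.Bundles using (_⇔_; mk⇔; Equivalence)
open import Data.List using (_∷_)
open import Data.List.Relation.Binary.Pointwise using (Pointwise; []; _∷_)
import Data.List.Relation.Binary.Pointwise as Pointwise
open import Data.Vec using (Vec; []; _∷_)
open import Relation.Binary.PropositionalEquality using (_≡_; _≢_; refl; cong; cong₂; subst)
open import Relation.Binary.Lattice.Structures using (IsBoundedLattice)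

module SubstitutionProperties (Sg : Signature) where
  open Syntax Sg

  infixl 5 _⨾_
  _⨾_ : Subst → Subst → Subst
  (θ ⨾ σ) x = θ x ⟪ σ ⟫

  mutual
    ⟪⟫-⨾ : ∀ t θ σ → t ⟪ θ ⟫ ⟪ σ ⟫ ≡ t ⟪ θ ⨾ σ ⟫
    ⟪⟫-⨾ (var x)    θ σ = refl
    ⟪⟫-⨾ (con c ts) θ σ = cong (con c) (⟪⟫*-⨾ ts θ σ)

    ⟪⟫*-⨾ : ∀ {n} (ts : Vec Term n) θ σ → ts ⟪ θ ⟫* ⟪ σ ⟫* ≡ ts ⟪ θ ⨾ σ ⟫*
    ⟪⟫*-⨾ []       θ σ = refl
    ⟪⟫*-⨾ (t ∷ ts) θ σ = cong₂ _∷_ (⟪⟫-⨾ t θ σ) (⟪⟫*-⨾ ts θ σ)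

  mutual
    ⟪⟫-identity : ∀ t → t ⟪ var ⟫ ≡ t
    ⟪⟫-identity (var x)    = refl
    ⟪⟫-identity (con c ts) = cong (con c) (⟪⟫*-identity ts)

    ⟪⟫*-identity : ∀ {n} (ts : Vec Term n) → ts ⟪ var ⟫* ≡ ts
    ⟪⟫*-identity []       = refl
    ⟪⟫*-identity (t ∷ ts) = cong₂ _∷_ (⟪⟫-identity t) (⟪⟫*-identity ts)

  ·-⨾ : ∀ A θ σ → (A · θ) · σ ≡ A · (θ ⨾ σ)
  ·-⨾ (atom p ts) θ σ = cong (atom p) (⟪⟫*-⨾ ts θ σ)

  ·-identity : ∀ A → A · var ≡ A
  ·-identity (atom p ts) = cong (atom p) (⟪⟫*-identity ts)

module FixpointSemantics (𝒟 : QualificationDomain) (Sg : Signature) where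
  open QualificationDomain 𝒟 using (_⊑_; ⊥D; isBoundedLattice)
  open QLP 𝒟 Sg
  open SubstitutionProperties Sg
  open IsBoundedLattice isBoundedLattice
    using (minimum) renaming (refl to ⊑-refl; trans to ⊑-trans; antisym to ⊑-antisym)

  ≢⊥-upward : ∀ {d e} → d ≢ ⊥D → d ⊑ e → e ≢ ⊥D
  ≢⊥-upward {d} d≢⊥ d⊑e refl = d≢⊥ (⊑-antisym d⊑e (minimum d))

  ∅-isInterpretation : IsInterpretation ∅
  ∅-isInterpretation = record { annotated = λ _ _ () ; closed = λ _ _ () }

  ⋃-isInterpretation : ∀ {X} {F : X → AtomSet} →
                       (∀ x → IsInterpretation (F x)) → IsInterpretation (⋃ F)
  ⋃-isInterpretation F-interp = record
    { annotated = λ A d (x , Ad) → IsInterpretation.annotated (F-interp x) A d Ad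
    ; closed    = λ A d (x , Ad) σ d′ d′≢⊥ d′⊑d →
                    x , IsInterpretation.closed (F-interp x) A d Ad σ d′ d′≢⊥ d′⊑d
    }

  BodyIn-mono : ∀ {I J} → I ⊆ J → ∀ θ {Bs ds} → BodyIn I θ Bs ds → BodyIn J θ Bs ds
  BodyIn-mono I⊆J θ = Pointwise.map (λ {B} {e} → I⊆J (B · θ) e)

  BodyIn-⨾ : ∀ {I} → IsInterpretation I → ∀ θ σ {Bs ds} →
             BodyIn I θ Bs ds → BodyIn I (θ ⨾ σ) Bs ds
  BodyIn-⨾ I-interp θ σ [] = []
  BodyIn-⨾ {I} I-interp θ σ {B ∷ _} {e ∷ _} (Bθe ∷ rest) =
    subst (λ A → I A e) (·-⨾ B θ σ) (closed _ e Bθe σ e (annotated _ e Bθe) ⊑-refl)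
    ∷ BodyIn-⨾ I-interp θ σ rest
    where open IsInterpretation I-interp

  BodyIn-⋃-directed : ∀ {X} {F : X → AtomSet} → IsDirected F → ∀ θ {Bs ds} →
                      BodyIn (⋃ F) θ Bs ds → Σ[ z ∈ X ] BodyIn (F z) θ Bs ds
  BodyIn-⋃-directed dir θ [] = IsDirected.nonempty dir , []
  BodyIn-⋃-directed dir θ ((x , Bθe) ∷ rest)
    with BodyIn-⋃-directed dir θ rest
  ... | y , rest-in-y with IsDirected.upper dir x y
  ... | z , Fx⊆Fz , Fy⊆Fz = z , Fx⊆Fz _ _ Bθe ∷ BodyIn-mono Fy⊆Fz θ rest-in-y

  module _ (P : Program) where

    T-isInterpretation : ∀ I → IsInterpretation I → IsInterpretation (T P I)
    T-isInterpretation I I-interp = record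
      { annotated = λ { _ _ (_ , _ , _ , _ , _ , _ , d≢⊥ , _) → d≢⊥ }
      ; closed    = λ { _ _ (C , PC , θ , ds , body , refl , _ , d⊑) σ d′ d′≢⊥ d′⊑d →
                          C , PC , θ ⨾ σ , ds , BodyIn-⨾ I-interp θ σ body
                          , ·-⨾ (Clause.head C) θ σ , d′≢⊥ , ⊑-trans d′⊑d d⊑ }
      }

    -- A body instance forces the head with qualification d ∘ glb ds; closure
    -- of I under entailment (with θ = var) supplies every smaller annotation.
    ⊨⇔T-prefixpoint : ∀ I → IsInterpretation I → (I ⊨ P ⇔ T P I ⊆ I)
    ⊨⇔T-prefixpoint I I-interp = mk⇔ to from
      where
      open IsInterpretation I-interp
      to : I ⊨ P → T P I ⊆ I
      to I⊨P _ d′ (C , PC , θ , ds , body , refl , d′≢⊥ , d′⊑) =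
        subst (λ A → I A d′) (·-identity _)
          (closed _ _ (I⊨P C PC θ ds body (≢⊥-upward d′≢⊥ d′⊑)) var d′ d′≢⊥ d′⊑)
      from : T P I ⊆ I → I ⊨ P
      from TI⊆I C PC θ ds body q≢⊥ = TI⊆I _ _ (C , PC , θ , ds , body , refl , q≢⊥ , ⊑-refl)

    T-mono : ∀ {I J} → I ⊆ J → T P I ⊆ T P J
    T-mono I⊆J _ _ (C , PC , θ , ds , body , eq , d≢⊥ , d⊑) =
      C , PC , θ , ds , BodyIn-mono I⊆J θ body , eq , d≢⊥ , d⊑

    T-continuous : Continuous (T P)
    T-continuous X F dir = T⋃⊆⋃T , ⋃T⊆T⋃
      where
      T⋃⊆⋃T : T P (⋃ F) ⊆ ⋃ (λ x → T P (F x))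
      T⋃⊆⋃T _ _ (C , PC , θ , ds , body , eq , d≢⊥ , d⊑)
        with BodyIn-⋃-directed dir θ body
      ... | z , body-in-z = z , C , PC , θ , ds , body-in-z , eq , d≢⊥ , d⊑
      ⋃T⊆T⋃ : ⋃ (λ x → T P (F x)) ⊆ T P (⋃ F)
      ⋃T⊆T⋃ A d (x , TFx) = T-mono {F x} {⋃ F} (λ _ _ Fx → x , Fx) A d TFx

    T↑-isInterpretation : ∀ n → IsInterpretation (T↑ P n)
    T↑-isInterpretation zero    = ∅-isInterpretation
    T↑-isInterpretation (suc n) = T-isInterpretation (T↑ P n) (T↑-isInterpretation n)

    T↑-mono : ∀ {m n} → m ≤ n → T↑ P m ⊆ T↑ P n
    T↑-mono {zero}           z≤n       _ _ ()
    T↑-mono {suc m} {suc n} (s≤s m≤n) = T-mono (T↑-mono m≤n)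

    T↑-directed : IsDirected (T↑ P)
    T↑-directed = record
      { interp   = T↑-isInterpretation
      ; nonempty = zero
      ; upper    = λ m n → m ⊔ n , T↑-mono (m≤m⊔n m n) , T↑-mono (m≤n⊔m m n)
      }

    T↑⊆prefixpoint : ∀ {J} → T P J ⊆ J → ∀ n → T↑ P n ⊆ J
    T↑⊆prefixpoint TJ⊆J zero    _ _ ()
    T↑⊆prefixpoint TJ⊆J (suc n) A d TT↑n = TJ⊆J A d (T-mono (T↑⊆prefixpoint TJ⊆J n) A d TT↑n)

    M : AtomSet
    M = ⋃ (T↑ P)

    M-isInterpretation : IsInterpretation M
    M-isInterpretation = ⋃-isInterpretation T↑-isInterpretation

    M⊆prefixpoint : ∀ {J} → T P J ⊆ J → M ⊆ J
    M⊆prefixpoint TJ⊆J A d (n , Ad) = T↑⊆prefixpoint TJ⊆J n A d Ad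

    M-fixpoint : T P M ≐ M
    M-fixpoint =
      (λ A d TMAd → let n , Ad = proj₁ (T-continuous ℕ (T↑ P) T↑-directed) A d TMAd
                    in suc n , Ad)
      , (λ A d (n , Ad) → proj₂ (T-continuous ℕ (T↑ P) T↑-directed) A d
                            (n , T↑-mono (n≤1+n n) A d Ad))

    Derivable-prefixpoint : T P (Derivable P) ⊆ Derivable P
    Derivable-prefixpoint _ _ (C , PC , θ , ds , body , refl , d≢⊥ , d⊑) =
      rule C PC θ ds body _ d≢⊥ d⊑

    mutual
      Derivable⊆prefixpoint : ∀ {J} → T P J ⊆ J → Derivable P ⊆ J
      Derivable⊆prefixpoint TJ⊆J _ _ (rule C PC θ ds body d′ d≢⊥ d⊑) =
        TJ⊆J _ _ (C , PC , θ , ds , derivable-body⊆prefixpoint TJ⊆J θ body , refl , d≢⊥ , d⊑)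

      derivable-body⊆prefixpoint : ∀ {J} → T P J ⊆ J → ∀ θ {Bs ds} →
        Pointwise (λ B e → P ⊢ B · θ ♯ e) Bs ds → BodyIn J θ Bs ds
      derivable-body⊆prefixpoint TJ⊆J θ []             = []
      derivable-body⊆prefixpoint TJ⊆J θ (Bθe ∷ rest) =
        Derivable⊆prefixpoint TJ⊆J _ _ Bθe ∷ derivable-body⊆prefixpoint TJ⊆J θ rest

    M-isLeastFixpoint : IsLeastFixpoint (T P) M
    M-isLeastFixpoint =
      M-isInterpretation , M-fixpoint , λ J _ TJ≐J → M⊆prefixpoint (proj₁ TJ≐J)

    M-isLeastModel : IsLeastModel P M
    M-isLeastModel =
      M-isInterpretation
      , Equivalence.from (⊨⇔T-prefixpoint M M-isInterpretation) (proj₁ M-fixpoint)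
      , λ J J-interp J⊨P → M⊆prefixpoint (Equivalence.to (⊨⇔T-prefixpoint J J-interp) J⊨P)

    M≐Derivable : M ≐ Derivable P
    M≐Derivable = M⊆prefixpoint Derivable-prefixpoint
                , Derivable⊆prefixpoint (proj₁ M-fixpoint)

proposition3 : (𝒟 : QualificationDomain) (Sg : Signature) →
    let open QLP 𝒟 Sg in
    (P : Program) →
      (∀ I → IsInterpretation I → IsInterpretation (T P I))
      × (∀ I → IsInterpretation I → (I ⊨ P ⇔ T P I ⊆ I))
      × Monotonic (T P) × Continuous (T P)
      × (Σ[ M ∈ AtomSet ]
           IsLeastFixpoint (T P) M × IsLeastModel P M
           × M ≐ ⋃ (λ (n : ℕ) → T↑ P n)
           × M ≐ Derivable P)
proposition3 𝒟 Sg P =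
  T-isInterpretation P , ⊨⇔T-prefixpoint P
  , (λ _ _ _ _ → T-mono P) , T-continuous P
  , M P , M-isLeastFixpoint P , M-isLeastModel P
  , ((λ _ _ Ad → Ad) , (λ _ _ Ad → Ad)) , M≐Derivable P
  where open FixpointSemantics 𝒟 Sg
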